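{- Let $G$ be a cubic graph that has a 3-decomposition, let $u$ be a vertex of $G$ with neighbours $w_1,w_2,w_3$, and let $H$ be the graph obtained from $G$ by deleting $u$, adding a triangle $u_1u_2u_3u_1$ on new vertices, and adding the edges $u_iw_i$ for $i=1,2,3$. Then $H$ has a 3-decomposition.
   Context: All graphs are finite and simple. A 3-decomposition of a graph $G$ is a triple $(T,C,M)$ of subgraphs such that every edge of $G$ lies in exactly one of them, $T$ is a spanning tree of $G$, $C$ is a (possibly empty) 2-regular graph, and $M$ is a (possibly empty) matching. -}

module Defs where

open import Data.Nat using (ℕ; zero; suc; _≤_)
open import Data.Bool using (Bool; true; false; not; if_then_else_)
open import Data.Fin using (Fin; splitAt; punchIn; _≟_)
open import Data.List using (List; []; _∷_; _∷ʳ_; length; map)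
open import Data.Nat.ListAction using (sum)
open import Data.List.Relation.Unary.Unique.Propositional using (Unique)
open import Data.List.Relation.Unary.Linked using (Linked)
open import Data.Product using (_×_; Σ; ∃)
open import Data.Sum using (_⊎_; inj₁; inj₂)
open import Data.Empty using (⊥)
open import Relation.Nullary using (¬_)
open import Relation.Nullary.Decidable using (⌊_⌋)
open import Relation.Binary.PropositionalEquality using (_≡_)
open import Data.List using () renaming (allFin to allFinL)

Graph : ℕ → Set
Graph n = Fin n → Fin n → Bool

IsSimple : ∀ {n} → Graph n → Set
IsSimple {n} G = (∀ x y → G x y ≡ G y x) × (∀ x → G x x ≡ false)

deg : ∀ {n} → Graph n → Fin n → ℕ
deg {n} A v = sum (map (λ w → if A v w then 1 else 0) (allFinL n))

Cubic : ∀ {n} → Graph n → Set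
Cubic G = ∀ v → deg G v ≡ 3

_⊆E_ : ∀ {n} → Graph n → Graph n → Set
A ⊆E B = ∀ x y → A x y ≡ true → B x y ≡ true

Symmetric : ∀ {n} → Graph n → Set
Symmetric A = ∀ x y → A x y ≡ A y x

data Walk {n} (A : Graph n) : Fin n → Fin n → Set where
  here : ∀ {x} → Walk A x x
  step : ∀ {x y z} → A x y ≡ true → Walk A y z → Walk A x z

Connected : ∀ {n} → Graph n → Set
Connected A = ∀ x y → Walk A x y

-- A cycle: distinct vertices x, z₁, …, z_k, z (k ≥ 1, so length ≥ 3),
-- consecutive ones adjacent, and z adjacent to x.
HasCycle : ∀ {n} → Graph n → Set
HasCycle {n} A =
  Σ (Fin n) λ x → Σ (Fin n) λ z → Σ (List (Fin n)) λ zs →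
    (1 ≤ length zs) × Unique (x ∷ (zs ∷ʳ z)) ×
    Linked (λ a b → A a b ≡ true) (x ∷ (zs ∷ʳ z)) × (A z x ≡ true)

IsSpanningTree : ∀ {n} → Graph n → Set
IsSpanningTree A = Connected A × ¬ HasCycle A

-- 2-regular subgraph (possibly empty): every vertex has degree 0 (not in C)
-- or 2.
IsTwoRegular : ∀ {n} → Graph n → Set
IsTwoRegular C = ∀ v → deg C v ≡ 0 ⊎ deg C v ≡ 2

IsMatching : ∀ {n} → Graph n → Set
IsMatching M = ∀ v → deg M v ≤ 1

record ThreeDecomposition {n} (G : Graph n) : Set where
  field
    T C M   : Graph n
    T-sym   : Symmetric T
    C-sym   : Symmetric C
    M-sym   : Symmetric M
    T⊆G     : T ⊆E G
    C⊆G     : C ⊆E G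
    M⊆G     : M ⊆E G
    cover   : ∀ x y → G x y ≡ true → T x y ≡ true ⊎ (C x y ≡ true ⊎ M x y ≡ true)
    disjTC  : ∀ x y → T x y ≡ true → C x y ≡ false
    disjTM  : ∀ x y → T x y ≡ true → M x y ≡ false
    disjCM  : ∀ x y → C x y ≡ true → M x y ≡ false
    T-tree  : IsSpanningTree T
    C-2reg  : IsTwoRegular C
    M-match : IsMatching M

-- Vertices of H = Fin (3 + n): the first three are the new vertices
-- u₁,u₂,u₃ ; vertex 3 + x corresponds to the G-vertex punchIn u x
-- (i.e. all vertices of G other than u).
inflateAdj : ∀ {n} → Graph (suc n) → Fin (suc n) → (Fin 3 → Fin (suc n)) →
             Fin 3 ⊎ Fin n → Fin 3 ⊎ Fin n → Bool
inflateAdj G u w (inj₁ i) (inj₁ j) = not ⌊ i ≟ j ⌋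
inflateAdj G u w (inj₁ i) (inj₂ x) = ⌊ w i ≟ punchIn u x ⌋
inflateAdj G u w (inj₂ x) (inj₁ i) = ⌊ w i ≟ punchIn u x ⌋
inflateAdj G u w (inj₂ x) (inj₂ y) = G (punchIn u x) (punchIn u y)

inflate : ∀ {n} → Graph (suc n) → Fin (suc n) → (Fin 3 → Fin (suc n)) → Graph (3 Data.Nat.+ n)
inflate G u w a b = inflateAdj G u w (splitAt 3 a) (splitAt 3 b)

{-# OPTIONS --safe #-}
module Submission where

-- Of the three edges u wᵢ, the 2-regular part C contains none or two and the matching M at
-- most one, so some edge u w_c is not in C while the other two lie both in C or both in T.
-- In the inflated graph each uᵢ wᵢ takes the class of u wᵢ, the two triangle edges at u_c
-- join the tree, and the opposite triangle edge joins C (lengthening the cycle through u) or M.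
-- The new tree is T with u blown up into the star at u_c. Contracting the star back onto u
-- carries walks to walks in T, and carries an edge together with a walk avoiding it (which is
-- what a cycle amounts to) to the same configuration in T.

open import Defs
open import Data.Nat using (ℕ; zero; suc; _+_; _≤_; z≤n; s≤s)
import Data.Nat as ℕ
open import Data.Nat.Properties using (+-0-commutativeMonoid; +-identityʳ; +-mono-≤; ≤-reflexive; n≮n; module ≤-Reasoning)
open import Data.Nat.Tactic.RingSolver using (solve-∀)
import Data.Nat.ListAction as ListAction
open import Data.Bool using (Bool; true; false; not; _∧_; _xor_; if_then_else_)
import Data.Bool.Properties as Bool
open import Data.Fin using (Fin; zero; suc; splitAt; join; punchIn; punchOut; _≟_)
open import Data.Fin.Patterns using (0F; 1F; 2F)
open import Data.Fin.Properties using (any?; all?; punchInᵢ≢i; punchIn-punchOut; punchIn-injective; splitAt-join; join-splitAt)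
import Data.Vec.Functional as Vector
import Data.List as List using (map; tabulate)
open import Data.List using (List; []; _∷_; _∷ʳ_)
open import Data.List.Relation.Unary.All using (All; []; _∷_)
open import Data.List.Relation.Unary.All.Properties using (¬Any⇒All¬; ∷ʳ⁻)
open import Data.List.Relation.Unary.Any as Any using (here; there)
open import Data.List.Relation.Unary.AllPairs using ([]; _∷_)
open import Data.List.Relation.Unary.Unique.Propositional using (Unique)
open import Data.List.Relation.Unary.Linked as Linked using (Linked; [-]; _∷_)
open import Data.List.Membership.Propositional using (_∈_)
open import Algebra.Properties.CommutativeMonoid.Sum +-0-commutativeMonoid using (sum; sum-syntax; sum-remove; ∑-comm; sum-cong-≗; sum-replicate-zero)
open import Data.Product using (_×_; ∃; ∃₂; _,_; proj₁; proj₂)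
open import Data.Sum using (_⊎_; inj₁; inj₂; [_,_])
open import Data.Unit using (⊤; tt)
open import Data.Empty using (⊥)
open import Function using (_∘_)
open import Function.Definitions using (Injective)
open import Relation.Nullary using (¬_; ¬?; Dec; yes; no; contradiction)
open import Relation.Nullary.Decidable using (⌊_⌋; isYes≗does; dec-true; dec-false; toWitness; _→-dec_; _×-dec_; _⊎-dec_)
open import Relation.Binary.PropositionalEquality using (_≡_; _≢_; refl; sym; trans; cong; cong₂; subst; subst₂; module ≡-Reasoning)
open import Relation.Binary.Construct.Closure.ReflexiveTransitive using (Star; ε; _◅_; _◅◅_; gmap; kleisliStar; reverse)

ι : Bool → ℕ
ι b = if b then 1 else 0

ι≤1 : ∀ b → ι b ≤ 1
ι≤1 true  = s≤s z≤n
ι≤1 false = z≤n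

sum-map-tabulate : ∀ {A : Set} {m} (f : A → ℕ) (g : Fin m → A) →
                   ListAction.sum (List.map f (List.tabulate g)) ≡ ∑[ i < m ] f (g i)
sum-map-tabulate {m = zero}  f g = refl
sum-map-tabulate {m = suc m} f g = cong (f (g zero) +_) (sum-map-tabulate f (g ∘ suc))

deg≡∑ : ∀ {m} (A : Graph m) v → deg A v ≡ ∑[ x < m ] ι (A v x)
deg≡∑ A v = sum-map-tabulate (λ x → ι (A v x)) (λ x → x)

∑-mono-≤ : ∀ {m} {f g : Fin m → ℕ} → (∀ i → f i ≤ g i) → ∑[ i < m ] f i ≤ ∑[ i < m ] g i
∑-mono-≤ {zero}  f≤g = z≤n
∑-mono-≤ {suc m} f≤g = +-mono-≤ (f≤g zero) (∑-mono-≤ (f≤g ∘ suc))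

∑-ones : ∀ m → ∑[ i < m ] 1 ≡ m
∑-ones zero    = refl
∑-ones (suc m) = cong suc (∑-ones m)

⌊≟⌋-true : ∀ {m} {p q : Fin m} → p ≡ q → ⌊ p ≟ q ⌋ ≡ true
⌊≟⌋-true {p = p} {q} p≡q = trans (isYes≗does (p ≟ q)) (dec-true (p ≟ q) p≡q)

⌊≟⌋-false : ∀ {m} {p q : Fin m} → p ≢ q → ⌊ p ≟ q ⌋ ≡ false
⌊≟⌋-false {p = p} {q} p≢q = trans (isYes≗does (p ≟ q)) (dec-false (p ≟ q) p≢q)

∧-≟-elim : ∀ {m} {p q : Fin m} {b} → ⌊ p ≟ q ⌋ ∧ b ≡ true → p ≡ q × b ≡ true
∧-≟-elim {p = p} {q} h with p ≟ q
... | yes p≡q = p≡q , h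

∧-≟-intro : ∀ {m} {p q : Fin m} {b} → p ≡ q → b ≡ true → ⌊ p ≟ q ⌋ ∧ b ≡ true
∧-≟-intro p≡q b≡true = cong₂ _∧_ (⌊≟⌋-true p≡q) b≡true

∑-indicator : ∀ {m} (q : Fin m) b → ∑[ x < m ] ι (⌊ q ≟ x ⌋ ∧ b) ≡ ι b
∑-indicator {suc m} q b = begin
  ∑[ x < suc m ] ι (⌊ q ≟ x ⌋ ∧ b)                           ≡⟨ sum-remove {i = q} (λ x → ι (⌊ q ≟ x ⌋ ∧ b)) ⟩
  ι (⌊ q ≟ q ⌋ ∧ b) + ∑[ y < m ] ι (⌊ q ≟ punchIn q y ⌋ ∧ b) ≡⟨ cong₂ _+_ hit (trans (sum-cong-≗ miss) (sum-replicate-zero m)) ⟩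
  ι b + 0                                                     ≡⟨ +-identityʳ (ι b) ⟩
  ι b                                                         ∎
  where
  open ≡-Reasoning
  hit : ι (⌊ q ≟ q ⌋ ∧ b) ≡ ι b
  hit = cong (λ d → ι (d ∧ b)) (⌊≟⌋-true refl)
  miss : ∀ y → ι (⌊ q ≟ punchIn q y ⌋ ∧ b) ≡ 0
  miss y = cong (λ d → ι (d ∧ b)) (⌊≟⌋-false (punchInᵢ≢i q y ∘ sym))

CoversNeighbours : ∀ {m d} → Graph m → Fin m → (Fin d → Fin m) → Set
CoversNeighbours A v w = ∀ p → A v p ≡ true → ∃ λ i → w i ≡ p

module Listed {m d} (X : Graph m) (v : Fin m) (w : Fin d → Fin m) where

  hits : Fin m → ℕ
  hits p = ∑[ i < d ] ι (⌊ w i ≟ p ⌋ ∧ X v (w i))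

  ∑-hits : ∑[ p < m ] hits p ≡ ∑[ i < d ] ι (X v (w i))
  ∑-hits = trans (∑-comm (λ p i → ι (⌊ w i ≟ p ⌋ ∧ X v (w i)))) (sum-cong-≗ (λ i → ∑-indicator (w i) (X v (w i))))

  hits-image : Injective _≡_ _≡_ w → ∀ k → hits (w k) ≡ ι (X v (w k))
  hits-image w-inj k = trans (sum-cong-≗ term) (∑-indicator k (X v (w k)))
    where
    term : ∀ i → ι (⌊ w i ≟ w k ⌋ ∧ X v (w i)) ≡ ι (⌊ k ≟ i ⌋ ∧ X v (w k))
    term i with w i ≟ w k | k ≟ i
    ... | yes _  | yes refl = refl
    ... | yes e  | no k≢i   = contradiction (sym (w-inj e)) k≢i
    ... | no ne  | yes refl = contradiction refl ne
    ... | no _   | no _     = refl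

  hits-outside : ∀ p → (∀ i → w i ≢ p) → hits p ≡ 0
  hits-outside p outside = trans (sum-cong-≗ term) (sum-replicate-zero d)
    where
    term : ∀ i → ι (⌊ w i ≟ p ⌋ ∧ X v (w i)) ≡ 0
    term i = cong (λ e → ι (e ∧ X v (w i))) (⌊≟⌋-false (outside i))

  hits≤adj : Injective _≡_ _≡_ w → ∀ p → hits p ≤ ι (X v p)
  hits≤adj w-inj p with any? (λ i → w i ≟ p)
  ... | yes (k , refl) = ≤-reflexive (hits-image w-inj k)
  ... | no missed      = subst (_≤ ι (X v p)) (sym (hits-outside p λ i e → missed (i , e))) z≤n

  adj≡hits : Injective _≡_ _≡_ w → CoversNeighbours X v w → ∀ p → ι (X v p) ≡ hits p
  adj≡hits w-inj covers p with any? (λ i → w i ≟ p)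
  ... | yes (k , refl) = sym (hits-image w-inj k)
  ... | no missed with X v p in Xvp
  ...   | true  = contradiction (covers p Xvp) missed
  ...   | false = sym (hits-outside p λ i e → missed (i , e))

  ∑-listed≤deg : Injective _≡_ _≡_ w → ∑[ i < d ] ι (X v (w i)) ≤ deg X v
  ∑-listed≤deg w-inj = begin
    ∑[ i < d ] ι (X v (w i)) ≡⟨ ∑-hits ⟨
    ∑[ p < m ] hits p         ≤⟨ ∑-mono-≤ (hits≤adj w-inj) ⟩
    ∑[ p < m ] ι (X v p)      ≡⟨ deg≡∑ X v ⟨
    deg X v                   ∎
    where open ≤-Reasoning

  deg≡∑-listed : Injective _≡_ _≡_ w → CoversNeighbours X v w → deg X v ≡ ∑[ i < d ] ι (X v (w i))
  deg≡∑-listed w-inj covers = begin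
    deg X v                  ≡⟨ deg≡∑ X v ⟩
    ∑[ p < m ] ι (X v p)     ≡⟨ sum-cong-≗ (adj≡hits w-inj covers) ⟩
    ∑[ p < m ] hits p        ≡⟨ ∑-hits ⟩
    ∑[ i < d ] ι (X v (w i)) ∎
    where open ≡-Reasoning

open Listed using (∑-listed≤deg; deg≡∑-listed; adj≡hits)

injective-neighbours≤deg : ∀ {m d} (A : Graph m) v (w : Fin d → Fin m) →
                           Injective _≡_ _≡_ w → (∀ i → A v (w i) ≡ true) → d ≤ deg A v
injective-neighbours≤deg {d = d} A v w w-inj adjacent =
  subst (_≤ deg A v) (trans (sum-cong-≗ (cong ι ∘ adjacent)) (∑-ones d)) (∑-listed≤deg A v w w-inj)

covers-by-degree : ∀ {m d} (A : Graph m) v (w : Fin d → Fin m) → deg A v ≡ d →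
                   Injective _≡_ _≡_ w → (∀ i → A v (w i) ≡ true) → CoversNeighbours A v w
covers-by-degree {d = d} A v w deg≡d w-inj adjacent p Avp with any? (λ i → w i ≟ p)
... | yes listed = listed
... | no missed  = contradiction (subst (suc d ≤_) deg≡d (injective-neighbours≤deg A v (p Vector.∷ w) p∷w-inj p∷w-adj)) (n≮n d)
  where
  p∷w-inj : Injective _≡_ _≡_ (p Vector.∷ w)
  p∷w-inj {zero}  {zero}  _ = refl
  p∷w-inj {zero}  {suc j} e = contradiction (j , sym e) missed
  p∷w-inj {suc i} {zero}  e = contradiction (i , e) missed
  p∷w-inj {suc i} {suc j} e = cong suc (w-inj e)
  p∷w-adj : ∀ i → A v ((p Vector.∷ w) i) ≡ true
  p∷w-adj zero    = Avp
  p∷w-adj (suc i) = adjacent i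

module _ {V : Set} (K : V → V → Bool) where

  Edge : V → V → Set
  Edge x y = K x y ≡ true

  EdgeOtherThan : V → V → V → V → Set
  EdgeOtherThan a b x y = Edge x y × ¬ (x ≡ a × y ≡ b) × ¬ (x ≡ b × y ≡ a)

  Bypass : V → V → Set
  Bypass a b = Edge b a × Star (EdgeOtherThan a b) a b

bypass-flip : ∀ {V : Set} {K : V → V → Bool} → (∀ x y → K x y ≡ K y x) →
              ∀ {a b} → Bypass K a b → Bypass K b a
bypass-flip {K = K} K-sym {a} {b} (ba , p) = trans (K-sym a b) ba , reverse flip p
  where
  flip : ∀ {x y} → EdgeOtherThan K a b x y → EdgeOtherThan K b a y x
  flip (xy , ¬ab , ¬ba) = trans (K-sym _ _) xy , (λ (yb , xa) → ¬ab (xa , yb)) , (λ (ya , xb) → ¬ba (xb , ya))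

walk⇒star : ∀ {m} {A : Graph m} {x y} → Walk A x y → Star (Edge A) x y
walk⇒star here       = ε
walk⇒star (step e w) = e ◅ walk⇒star w

star⇒walk : ∀ {m} {A : Graph m} {x y} → Star (Edge A) x y → Walk A x y
star⇒walk ε       = here
star⇒walk (e ◅ p) = step e (star⇒walk p)

contract-walk : ∀ {V W : Set} {R : V → V → Set} {S : W → W → Set} (f : V → W) →
                (∀ {x y} → R x y → f x ≡ f y ⊎ S (f x) (f y)) → ∀ {x y} → Star R x y → Star S (f x) (f y)
contract-walk {S = S} f image = kleisliStar f (λ r → [ (λ e → subst (Star S _) e ε) , (_◅ ε) ] (image r))

walk-avoiding : ∀ {m} (A : Graph m) {x} z y ys → Linked (Edge A) (y ∷ (ys ∷ʳ z)) →
                All (x ≢_) (y ∷ (ys ∷ʳ z)) → Star (EdgeOtherThan A x z) y z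
walk-avoiding A z y []        (e ∷ [-]) (x≢y ∷ x≢z ∷ []) =
  (e , x≢y ∘ sym ∘ proj₁ , x≢z ∘ sym ∘ proj₂) ◅ ε
walk-avoiding A z y (y′ ∷ ys) (e ∷ l)   (x≢y ∷ rest@(x≢y′ ∷ _)) =
  (e , x≢y ∘ sym ∘ proj₁ , x≢y′ ∘ sym ∘ proj₂) ◅ walk-avoiding A z y′ ys l rest

cycle⇒bypass : ∀ {m} (A : Graph m) → HasCycle A → ∃₂ λ a b → Bypass A a b
cycle⇒bypass A (x , z , [] , () , _)
cycle⇒bypass A (x , z , y ∷ ys , _ , (x∉ ∷ (y∉ ∷ _)) , (xy ∷ linked) , zx) =
  x , z , zx , (xy , y≢z ∘ proj₂ , x≢z ∘ proj₁) ◅ walk-avoiding A z y ys linked x∉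
  where
  x≢z : x ≢ z
  x≢z = proj₂ (∷ʳ⁻ {xs = y ∷ ys} x∉)
  y≢z : y ≢ z
  y≢z = proj₂ (∷ʳ⁻ {xs = ys} y∉)

data WalkThrough {V : Set} (R : V → V → Set) : V → V → List V → Set where
  stop : ∀ {x} → WalkThrough R x x (x ∷ [])
  go   : ∀ {x y z vs} → R x y → WalkThrough R y z vs → WalkThrough R x z (x ∷ vs)

module _ {V : Set} {R : V → V → Set} where

  walkThrough-linked : ∀ {s t vs} → WalkThrough R s t vs → Linked R vs
  walkThrough-linked stop              = [-]
  walkThrough-linked (go r stop)       = r ∷ [-]
  walkThrough-linked (go r q@(go _ _)) = r ∷ walkThrough-linked q

  walkThrough-last : ∀ {s t vs} → WalkThrough R s t vs → ∃ λ ys → vs ≡ ys ∷ʳ t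
  walkThrough-last stop = [] , refl
  walkThrough-last {s} (go r q) with walkThrough-last q
  ... | ys , refl = s ∷ ys , refl

module _ {m} {R : Fin m → Fin m → Set} where

  suffix-from : ∀ {s s′ t vs} → WalkThrough R s′ t vs → Unique vs → s ∈ vs →
                ∃ λ vs′ → WalkThrough R s t vs′ × Unique vs′
  suffix-from stop        q-unique       (here refl) = _ , stop , q-unique
  suffix-from q@(go _ _)  q-unique       (here refl) = _ , q , q-unique
  suffix-from (go _ q)    (_ ∷ q-unique) (there s∈)  = suffix-from q q-unique s∈

  erase-loops : ∀ {s t} → Star R s t → ∃ λ vs → WalkThrough R s t vs × Unique vs
  erase-loops ε = _ , stop , [] ∷ []
  erase-loops {s} (r ◅ p) with erase-loops p
  ... | vs , q , q-unique with Any.any? (s ≟_) vs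
  ...   | yes s∈vs = suffix-from q q-unique s∈vs
  ...   | no s∉vs  = s ∷ vs , go r q , ¬Any⇒All¬ vs s∉vs ∷ q-unique

bypass⇒cycle : ∀ {m} (A : Graph m) {a b} → a ≢ b → Bypass A a b → HasCycle A
bypass⇒cycle A a≢b (ba , p) with erase-loops p
... | _ , stop , _                 = contradiction refl a≢b
... | _ , go (_ , ¬ab , _) stop , _ = contradiction (refl , refl) ¬ab
... | _ , q@(go {y = y} _ (go _ q′)) , unique with walkThrough-last q′
...   | ys , refl = _ , _ , y ∷ ys , s≤s z≤n , unique , Linked.map proj₁ (walkThrough-linked q) , ba

module Relabelling {m} {V : Set} (f : Fin m → V) (g : V → Fin m)
                   (f∘g : ∀ s → f (g s) ≡ s) (g∘f : ∀ a → g (f a) ≡ a)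
                   (K : V → V → Bool) where

  K∘f : Graph m
  K∘f a b = K (f a) (f b)

  spanningTree : (∀ s t → Star (Edge K) s t) → (∀ s t → ¬ Bypass K s t) → IsSpanningTree K∘f
  spanningTree connected acyclic = connected′ , acyclic′
    where
    f-inj : ∀ {a b} → f a ≡ f b → a ≡ b
    f-inj {a} {b} e = trans (sym (g∘f a)) (trans (cong g e) (g∘f b))
    connected′ : Connected K∘f
    connected′ a b = subst₂ (Walk K∘f) (g∘f a) (g∘f b) (star⇒walk (gmap g relabel (connected (f a) (f b))))
      where
      relabel : ∀ {s t} → Edge K s t → Edge K∘f (g s) (g t)
      relabel {s} {t} = subst₂ (λ s′ t′ → K s′ t′ ≡ true) (sym (f∘g s)) (sym (f∘g t))
    acyclic′ : ¬ HasCycle K∘f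
    acyclic′ cycle with cycle⇒bypass K∘f cycle
    ... | a , b , ba , p = acyclic (f a) (f b) (ba , gmap f project p)
      where
      project : ∀ {x y} → EdgeOtherThan K∘f a b x y → EdgeOtherThan K (f a) (f b) (f x) (f y)
      project (xy , ¬ab , ¬ba) = xy , (λ (xa , yb) → ¬ab (f-inj xa , f-inj yb)) , (λ (xb , ya) → ¬ba (f-inj xb , f-inj ya))

triangle : Fin 3 → Fin 3 → Bool
triangle i j = not ⌊ i ≟ j ⌋

star : Fin 3 → Fin 3 → Fin 3 → Bool
star c i j = ⌊ i ≟ c ⌋ xor ⌊ j ≟ c ⌋

opposite : Fin 3 → Fin 3 → Fin 3 → Bool
opposite c i j = not ⌊ i ≟ c ⌋ ∧ not ⌊ j ≟ c ⌋ ∧ triangle i j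

star-sym : ∀ c i j → star c i j ≡ star c j i
star-sym = toWitness {a? = all? λ c → all? λ i → all? λ j → star c i j Bool.≟ star c j i} _

opposite-sym : ∀ c i j → opposite c i j ≡ opposite c j i
opposite-sym = toWitness {a? = all? λ c → all? λ i → all? λ j → opposite c i j Bool.≟ opposite c j i} _

star⊆triangle : ∀ c i j → star c i j ≡ true → triangle i j ≡ true
star⊆triangle = toWitness {a? = all? λ c → all? λ i → all? λ j →
  (star c i j Bool.≟ true) →-dec (triangle i j Bool.≟ true)} _

opposite⊆triangle : ∀ c i j → opposite c i j ≡ true → triangle i j ≡ true
opposite⊆triangle = toWitness {a? = all? λ c → all? λ i → all? λ j →
  (opposite c i j Bool.≟ true) →-dec (triangle i j Bool.≟ true)} _

triangle⊆star∪opposite : ∀ c i j → triangle i j ≡ true → star c i j ≡ true ⊎ opposite c i j ≡ true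
triangle⊆star∪opposite = toWitness {a? = all? λ c → all? λ i → all? λ j →
  (triangle i j Bool.≟ true) →-dec ((star c i j Bool.≟ true) ⊎-dec (opposite c i j Bool.≟ true))} _

star∩opposite : ∀ c i j → star c i j ≡ true → opposite c i j ≡ false
star∩opposite = toWitness {a? = all? λ c → all? λ i → all? λ j →
  (star c i j Bool.≟ true) →-dec (opposite c i j Bool.≟ false)} _

star-edge : ∀ c i j → star c i j ≡ true → (i ≡ c × j ≢ c) ⊎ (j ≡ c × i ≢ c)
star-edge = toWitness {a? = all? λ c → all? λ i → all? λ j →
  (star c i j Bool.≟ true) →-dec ((i ≟ c ×-dec ¬? (j ≟ c)) ⊎-dec (j ≟ c ×-dec ¬? (i ≟ c)))} _

star-to-centre : ∀ c i → i ≢ c → star c i c ≡ true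
star-to-centre = toWitness {a? = all? λ c → all? λ i → ¬? (i ≟ c) →-dec (star c i c Bool.≟ true)} _

∑-opposite-centre : ∀ c b → ∑[ j < 3 ] ι (b ∧ opposite c c j) ≡ 0
∑-opposite-centre c false = refl
∑-opposite-centre c true  = toWitness {a? = all? λ c → ∑[ j < 3 ] ι (opposite c c j) ℕ.≟ 0} _ c

∑-opposite-other : ∀ c i b → i ≢ c → ∑[ j < 3 ] ι (b ∧ opposite c i j) ≡ ι b
∑-opposite-other c i false _ = refl
∑-opposite-other c i true  = toWitness {a? = all? λ c → all? λ i → ¬? (i ≟ c) →-dec (∑[ j < 3 ] ι (opposite c i j) ℕ.≟ 1)} _ c i

ZeroOrTwo : ℕ → Set
ZeroOrTwo k = k ≡ 0 ⊎ k ≡ 2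

-- The two edges u wᵢ with i ≢ centre lie in C if others is true, and in T otherwise.
record Centre (inC inM : Fin 3 → Bool) : Set where
  field
    centre   : Fin 3
    others   : Bool
    centre∉C : inC centre ≡ false
    other∉M  : ∀ i → i ≢ centre → inM i ≡ false
    other∈C  : ∀ i → i ≢ centre → inC i ≡ others

choose-centre : ∀ (inC inM : Fin 3 → Bool) →
                ZeroOrTwo (∑[ i < 3 ] ι (inC i)) → ∑[ i < 3 ] ι (inM i) ≤ 1 →
                (∀ i → inC i ≡ true → inM i ≡ false) → Centre inC inM
choose-centre inC inM C-even M-small C∩M with inC 0F in c₀ | inC 1F in c₁ | inC 2F in c₂
... | true  | true  | true  = contradiction C-even λ { (inj₁ ()) ; (inj₂ ()) }
... | true  | false | false = contradiction C-even λ { (inj₁ ()) ; (inj₂ ()) }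
... | false | true  | false = contradiction C-even λ { (inj₁ ()) ; (inj₂ ()) }
... | false | false | true  = contradiction C-even λ { (inj₁ ()) ; (inj₂ ()) }
... | false | true  | true  = record { centre = 0F ; others = true ; centre∉C = c₀
  ; other∉M = λ { 0F 0≢0 → contradiction refl 0≢0 ; 1F _ → C∩M 1F c₁ ; 2F _ → C∩M 2F c₂ }
  ; other∈C = λ { 0F 0≢0 → contradiction refl 0≢0 ; 1F _ → c₁ ; 2F _ → c₂ } }
... | true  | false | true  = record { centre = 1F ; others = true ; centre∉C = c₁
  ; other∉M = λ { 0F _ → C∩M 0F c₀ ; 1F 1≢1 → contradiction refl 1≢1 ; 2F _ → C∩M 2F c₂ }
  ; other∈C = λ { 0F _ → c₀ ; 1F 1≢1 → contradiction refl 1≢1 ; 2F _ → c₂ } }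
... | true  | true  | false = record { centre = 2F ; others = true ; centre∉C = c₂
  ; other∉M = λ { 0F _ → C∩M 0F c₀ ; 1F _ → C∩M 1F c₁ ; 2F 2≢2 → contradiction refl 2≢2 }
  ; other∈C = λ { 0F _ → c₀ ; 1F _ → c₁ ; 2F 2≢2 → contradiction refl 2≢2 } }
... | false | false | false with inM 0F in m₀ | inM 1F in m₁ | inM 2F in m₂
...   | true  | true  | _     = contradiction M-small λ { (s≤s ()) }
...   | true  | false | true  = contradiction M-small λ { (s≤s ()) }
...   | false | true  | true  = contradiction M-small λ { (s≤s ()) }
...   | true  | false | false = record { centre = 0F ; others = false ; centre∉C = c₀
  ; other∉M = λ { 0F 0≢0 → contradiction refl 0≢0 ; 1F _ → m₁ ; 2F _ → m₂ }
  ; other∈C = λ { 0F 0≢0 → contradiction refl 0≢0 ; 1F _ → c₁ ; 2F _ → c₂ } }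
...   | false | true  | false = record { centre = 1F ; others = false ; centre∉C = c₁
  ; other∉M = λ { 0F _ → m₀ ; 1F 1≢1 → contradiction refl 1≢1 ; 2F _ → m₂ }
  ; other∈C = λ { 0F _ → c₀ ; 1F 1≢1 → contradiction refl 1≢1 ; 2F _ → c₂ } }
...   | false | false | _     = record { centre = 2F ; others = false ; centre∉C = c₂
  ; other∉M = λ { 0F _ → m₀ ; 1F _ → m₁ ; 2F 2≢2 → contradiction refl 2≢2 }
  ; other∈C = λ { 0F _ → c₀ ; 1F _ → c₁ ; 2F 2≢2 → contradiction refl 2≢2 } }

module Inflation {n} (G : Graph (suc n)) (G-simple : IsSimple G) (D : ThreeDecomposition G)
                 (u : Fin (suc n)) (w : Fin 3 → Fin (suc n))
                 (w-inj : Injective _≡_ _≡_ w) (w-adj : ∀ i → G u (w i) ≡ true)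
                 (G-covers : CoversNeighbours G u w) where

  open ThreeDecomposition D

  V : Set
  V = Fin 3 ⊎ Fin n

  old : Fin n → Fin (suc n)
  old = punchIn u

  old≢u : ∀ x → old x ≢ u
  old≢u = punchInᵢ≢i u

  w≢u : ∀ i → w i ≢ u
  w≢u i wi≡u = contradiction (trans (sym (subst (λ p → G u p ≡ true) wi≡u (w-adj i))) (proj₂ G-simple u)) λ ()

  covers : ∀ {X} → X ⊆E G → CoversNeighbours X u w
  covers X⊆G p Xup = G-covers p (X⊆G u p Xup)

  extend : Graph (suc n) → (Fin 3 → Fin 3 → Bool) → V → V → Bool
  extend X tri (inj₁ i) (inj₁ j) = tri i j
  extend X tri (inj₁ i) (inj₂ y) = ⌊ w i ≟ old y ⌋ ∧ X u (w i)
  extend X tri (inj₂ x) (inj₁ j) = ⌊ w j ≟ old x ⌋ ∧ X u (w j)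
  extend X tri (inj₂ x) (inj₂ y) = X (old x) (old y)

  lift : (V → V → Bool) → Graph (3 + n)
  lift K a b = K (splitAt 3 a) (splitAt 3 b)

  extend-sym : ∀ {X tri} → Symmetric X → (∀ i j → tri i j ≡ tri j i) →
               ∀ s t → extend X tri s t ≡ extend X tri t s
  extend-sym X-sym tri-sym (inj₁ i) (inj₁ j) = tri-sym i j
  extend-sym X-sym tri-sym (inj₁ i) (inj₂ y) = refl
  extend-sym X-sym tri-sym (inj₂ x) (inj₁ j) = refl
  extend-sym X-sym tri-sym (inj₂ x) (inj₂ y) = X-sym (old x) (old y)

  extend⊆ : ∀ {X tri} → X ⊆E G → (∀ i j → tri i j ≡ true → triangle i j ≡ true) →
            ∀ s t → extend X tri s t ≡ true → inflateAdj G u w s t ≡ true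
  extend⊆ X⊆G tri⊆ (inj₁ i) (inj₁ j) e = tri⊆ i j e
  extend⊆ X⊆G tri⊆ (inj₁ i) (inj₂ y) e = ⌊≟⌋-true (proj₁ (∧-≟-elim e))
  extend⊆ X⊆G tri⊆ (inj₂ x) (inj₁ j) e = ⌊≟⌋-true (proj₁ (∧-≟-elim e))
  extend⊆ X⊆G tri⊆ (inj₂ x) (inj₂ y) e = X⊆G (old x) (old y) e

  extend-disjoint : ∀ {X Y tri tri′} → (∀ p q → X p q ≡ true → Y p q ≡ false) →
                    (∀ i j → tri i j ≡ true → tri′ i j ≡ false) →
                    ∀ s t → extend X tri s t ≡ true → extend Y tri′ s t ≡ false
  extend-disjoint X∩Y tri∩tri′ (inj₁ i) (inj₁ j) e = tri∩tri′ i j e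
  extend-disjoint X∩Y tri∩tri′ (inj₁ i) (inj₂ y) e with w i ≟ old y
  ... | yes _ = X∩Y u (w i) e
  ... | no _  = refl
  extend-disjoint X∩Y tri∩tri′ (inj₂ x) (inj₁ j) e with w j ≟ old x
  ... | yes _ = X∩Y u (w j) e
  ... | no _  = refl
  extend-disjoint X∩Y tri∩tri′ (inj₂ x) (inj₂ y) e = X∩Y (old x) (old y) e

  degV : (V → V → Bool) → V → ℕ
  degV K s = ∑[ j < 3 ] ι (K s (inj₁ j)) + ∑[ y < n ] ι (K s (inj₂ y))

  deg-lift : ∀ K a → deg (lift K) a ≡ degV K (splitAt 3 a)
  deg-lift K a = trans (deg≡∑ (lift K) a) (regroup (edge 0F) (edge 1F) (edge 2F) (∑[ y < n ] ι (K (splitAt 3 a) (inj₂ y))))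
    where
    edge : Fin 3 → ℕ
    edge j = ι (K (splitAt 3 a) (inj₁ j))
    regroup : ∀ a b c s → a + (b + (c + s)) ≡ (a + (b + (c + 0))) + s
    regroup = solve-∀

  ∑-attached : ∀ i b → ∑[ y < n ] ι (⌊ w i ≟ old y ⌋ ∧ b) ≡ ι b
  ∑-attached i b = begin
    rest                                ≡⟨ cong (λ d → ι (d ∧ b) + rest) (⌊≟⌋-false (w≢u i)) ⟨
    ι (⌊ w i ≟ u ⌋ ∧ b) + rest          ≡⟨ sum-remove {i = u} (λ x → ι (⌊ w i ≟ x ⌋ ∧ b)) ⟨
    ∑[ x < suc n ] ι (⌊ w i ≟ x ⌋ ∧ b)  ≡⟨ ∑-indicator (w i) b ⟩
    ι b                                 ∎
    where
    open ≡-Reasoning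
    rest : ℕ
    rest = ∑[ y < n ] ι (⌊ w i ≟ old y ⌋ ∧ b)

  deg-extend-new : ∀ X tri i → degV (extend X tri) (inj₁ i) ≡ ∑[ j < 3 ] ι (tri i j) + ι (X u (w i))
  deg-extend-new X tri i = cong (∑[ j < 3 ] ι (tri i j) +_) (∑-attached i (X u (w i)))

  deg-extend-old : ∀ {X} tri → Symmetric X → X ⊆E G → ∀ x → degV (extend X tri) (inj₂ x) ≡ deg X (old x)
  deg-extend-old {X} tri X-sym X⊆G x = sym (begin
    deg X (old x)                   ≡⟨ deg≡∑ X (old x) ⟩
    ∑[ p < suc n ] ι (X (old x) p)  ≡⟨ sum-remove {i = u} (λ p → ι (X (old x) p)) ⟩
    ι (X (old x) u) + rest          ≡⟨ cong (λ b → ι b + rest) (X-sym (old x) u) ⟩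
    ι (X u (old x)) + rest          ≡⟨ cong (_+ rest) (adj≡hits X u w w-inj (covers X⊆G) (old x)) ⟩
    degV (extend X tri) (inj₂ x)    ∎)
    where
    open ≡-Reasoning
    rest : ℕ
    rest = ∑[ y < n ] ι (X (old x) (old y))

  module SpanningTree (c : Fin 3) where

    T′ : V → V → Bool
    T′ = extend T (star c)

    T′-sym : ∀ s t → T′ s t ≡ T′ t s
    T′-sym = extend-sym T-sym (star-sym c)

    T-loopless : ∀ p → T p p ≢ true
    T-loopless p Tpp = contradiction (trans (sym (T⊆G p p Tpp)) (proj₂ G-simple p)) λ ()

    T-acyclic : ¬ HasCycle T
    T-acyclic = proj₂ T-tree

    new-to-centre : ∀ i → Star (Edge T′) (inj₁ i) (inj₁ c)
    new-to-centre i with i ≟ c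
    ... | yes refl = ε
    ... | no i≢c   = star-to-centre c i i≢c ◅ ε

    T-neighbour-of-u : ∀ x → T u (old x) ≡ true → ∃ λ k → Edge T′ (inj₂ x) (inj₁ k)
    T-neighbour-of-u x Tux with covers T⊆G (old x) Tux
    ... | k , wk≡x = k , ∧-≟-intro wk≡x (subst (λ p → T u p ≡ true) (sym wk≡x) Tux)

    old-to-centre : ∀ {q} → Star (Edge T) q u → ∀ x → old x ≡ q → Star (Edge T′) (inj₂ x) (inj₁ c)
    old-to-centre ε x old≡u = contradiction old≡u (old≢u x)
    old-to-centre (_◅_ {j = q} Txq rest) x refl with q ≟ u
    ... | yes refl = proj₂ attach ◅ new-to-centre (proj₁ attach)
      where
      attach : ∃ λ k → Edge T′ (inj₂ x) (inj₁ k)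
      attach = T-neighbour-of-u x (trans (T-sym u (old x)) Txq)
    ... | no q≢u   = subst (λ p → T (old x) p ≡ true) (sym (punchIn-punchOut u≢q)) Txq
                     ◅ old-to-centre rest (punchOut u≢q) (punchIn-punchOut u≢q)
      where
      u≢q : u ≢ q
      u≢q = q≢u ∘ sym

    to-centre : ∀ s → Star (Edge T′) s (inj₁ c)
    to-centre (inj₁ i) = new-to-centre i
    to-centre (inj₂ x) = old-to-centre (walk⇒star (proj₁ T-tree (old x) u)) x refl

    connected : ∀ s t → Star (Edge T′) s t
    connected s t = to-centre s ◅◅ reverse (λ {x} {y} e → trans (T′-sym y x) e) (to-centre t)

    π : V → Fin (suc n)
    π (inj₁ _) = u
    π (inj₂ x) = old x

    External : V → V → Set
    External (inj₁ _) (inj₁ _) = ⊥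
    External _        _        = ⊤

    project : ∀ s t → External s t → Edge T′ s t → Edge T (π s) (π t)
    project (inj₁ i) (inj₂ y) _ e with ∧-≟-elim e
    ... | wi≡y , Tuwi = subst (λ p → T u p ≡ true) wi≡y Tuwi
    project (inj₂ x) (inj₁ j) _ e with ∧-≟-elim e
    ... | wj≡x , Tuwj = trans (T-sym (old x) u) (subst (λ p → T u p ≡ true) wj≡x Tuwj)
    project (inj₂ x) (inj₂ y) _ e = e

    π≡old : ∀ s x → π s ≡ old x → s ≡ inj₂ x
    π≡old (inj₁ _) x u≡x = contradiction (sym u≡x) (old≢u x)
    π≡old (inj₂ y) x y≡x = cong inj₂ (punchIn-injective u y x y≡x)

    π≡u : ∀ s → π s ≡ u → ∃ λ j → s ≡ inj₁ j
    π≡u (inj₁ j) _   = j , refl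
    π≡u (inj₂ y) y≡u = contradiction y≡u (old≢u y)

    external-determined : ∀ {v v′ s t} → External v v′ → Edge T′ v v′ → Edge T′ s t →
                          π v ≡ π s → π v′ ≡ π t → v ≡ s × v′ ≡ t
    external-determined {inj₁ i} {inj₂ y} {s} {t} _ e e′ πv πv′ with π≡u s (sym πv) | π≡old t y (sym πv′)
    ... | j , refl | refl = cong inj₁ (w-inj (trans (proj₁ (∧-≟-elim e)) (sym (proj₁ (∧-≟-elim e′))))) , refl
    external-determined {inj₂ x} {inj₁ i} {s} {t} _ e e′ πv πv′ with π≡old s x (sym πv) | π≡u t (sym πv′)
    ... | refl | j , refl = refl , cong inj₁ (w-inj (trans (proj₁ (∧-≟-elim e)) (sym (proj₁ (∧-≟-elim e′)))))
    external-determined {inj₂ x} {inj₂ y} {s} {t} _ e e′ πv πv′ = sym (π≡old s x (sym πv)) , sym (π≡old t y (sym πv′))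

    no-external-bypass : ∀ s t → External s t → ¬ Bypass T′ s t
    no-external-bypass s t ext (ts , p) =
      T-acyclic (bypass⇒cycle T πs≢πt (trans (T-sym (π t) (π s)) (project s t ext st) , contract-walk π image-of-step p))
      where
      st : Edge T′ s t
      st = trans (T′-sym s t) ts
      πs≢πt : π s ≢ π t
      πs≢πt πs≡πt = T-loopless (π t) (subst (λ p → T p (π t) ≡ true) πs≡πt (project s t ext st))
      external-step : ∀ {v v′} → External v v′ → EdgeOtherThan T′ s t v v′ → EdgeOtherThan T (π s) (π t) (π v) (π v′)
      external-step ext′ (e , ¬st , ¬ts) = project _ _ ext′ e ,
        (λ (πv , πv′) → ¬st (external-determined ext′ e st πv πv′)) ,
        (λ (πv , πv′) → ¬ts (external-determined ext′ e ts πv πv′))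
      image-of-step : ∀ {v v′} → EdgeOtherThan T′ s t v v′ → π v ≡ π v′ ⊎ EdgeOtherThan T (π s) (π t) (π v) (π v′)
      image-of-step {inj₁ _} {inj₁ _} _ = inj₁ refl
      image-of-step {inj₁ _} {inj₂ _} r = inj₂ (external-step tt r)
      image-of-step {inj₂ _} {inj₁ _} r = inj₂ (external-step tt r)
      image-of-step {inj₂ _} {inj₂ _} r = inj₂ (external-step tt r)

    -- Here u_k is contracted onto w_k instead: the bypass of u_c u_k becomes one of u w_k in T,
    -- and u w_k ∈ T because the walk must leave u_k through u_k w_k.
    no-star-bypass : ∀ k → k ≢ c → ¬ Bypass T′ (inj₁ c) (inj₁ k)
    no-star-bypass k k≢c bypass@(_ , p) =
      T-acyclic (bypass⇒cycle T (w≢u k ∘ sym)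
        (trans (T-sym (w k) u) Tuwk , subst₂ (Star _) πₖ-centre πₖ-k (contract-walk πₖ image-of-step p)))
      where
      first-step : ∀ {v} → EdgeOtherThan T′ (inj₁ k) (inj₁ c) (inj₁ k) v → T u (w k) ≡ true
      first-step {inj₁ j} (e , ¬kc , _) with star-edge c k j e
      ... | inj₁ (k≡c , _) = contradiction k≡c k≢c
      ... | inj₂ (refl , _) = contradiction (refl , refl) ¬kc
      first-step {inj₂ y} (e , _) = proj₂ (∧-≟-elim e)
      Tuwk : T u (w k) ≡ true
      Tuwk with bypass-flip T′-sym bypass
      ... | _ , ε       = contradiction refl k≢c
      ... | _ , r ◅ _   = first-step r
      πₖ : V → Fin (suc n)
      πₖ (inj₁ j) = if ⌊ j ≟ k ⌋ then w k else u
      πₖ (inj₂ x) = old x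
      πₖ-centre : πₖ (inj₁ c) ≡ u
      πₖ-centre = cong (λ b → if b then w k else u) (⌊≟⌋-false (k≢c ∘ sym))
      πₖ-k : πₖ (inj₁ k) ≡ w k
      πₖ-k = cong (λ b → if b then w k else u) (⌊≟⌋-true refl)
      image-of-step : ∀ {v v′} → EdgeOtherThan T′ (inj₁ c) (inj₁ k) v v′ →
                      πₖ v ≡ πₖ v′ ⊎ EdgeOtherThan T u (w k) (πₖ v) (πₖ v′)
      image-of-step {inj₁ i} {inj₁ j} (e , ¬ck , ¬kc) with star-edge c i j e
      ... | inj₁ (refl , _) with j ≟ k
      ...   | yes refl = contradiction (refl , refl) ¬ck
      ...   | no j≢k   = inj₁ πₖ-centre
      image-of-step {inj₁ i} {inj₁ j} (e , ¬ck , ¬kc) | inj₂ (refl , _) with i ≟ k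
      ...   | yes refl = contradiction (refl , refl) ¬kc
      ...   | no i≢k   = inj₁ (sym πₖ-centre)
      image-of-step {inj₁ i} {inj₂ y} (e , _) with ∧-≟-elim e | i ≟ k
      ... | wi≡y , _    | yes refl = inj₁ wi≡y
      ... | wi≡y , Tuwi | no i≢k   = inj₂ (subst (λ p → T u p ≡ true) wi≡y Tuwi ,
                                           (λ (_ , y≡wk) → i≢k (w-inj (trans wi≡y y≡wk))) ,
                                           (λ (u≡wk , _) → w≢u k (sym u≡wk)))
      image-of-step {inj₂ x} {inj₁ j} (e , _) with ∧-≟-elim e | j ≟ k
      ... | wj≡x , _    | yes refl = inj₁ (sym wj≡x)
      ... | wj≡x , Tuwj | no j≢k   = inj₂ (trans (T-sym (old x) u) (subst (λ p → T u p ≡ true) wj≡x Tuwj) ,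
                                           (λ (x≡u , _) → old≢u x x≡u) ,
                                           (λ (x≡wk , _) → j≢k (w-inj (trans wj≡x x≡wk))))
      image-of-step {inj₂ x} {inj₂ y} (e , _) = inj₂ (e , (λ (x≡u , _) → old≢u x x≡u) , (λ (_ , y≡u) → old≢u y y≡u))

    no-bypass : ∀ s t → ¬ Bypass T′ s t
    no-bypass (inj₁ i) (inj₁ j) bypass@(ji , _) with star-edge c j i ji
    ... | inj₁ (refl , i≢c) = no-star-bypass i i≢c (bypass-flip T′-sym bypass)
    ... | inj₂ (refl , j≢c) = no-star-bypass j j≢c bypass
    no-bypass (inj₁ i) (inj₂ y) = no-external-bypass _ _ tt
    no-bypass (inj₂ x) (inj₁ j) = no-external-bypass _ _ tt
    no-bypass (inj₂ x) (inj₂ y) = no-external-bypass _ _ tt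

    spanning : IsSpanningTree (lift T′)
    spanning = Relabelling.spanningTree (splitAt 3) (join 3 n) (splitAt-join 3 n) (join-splitAt 3 n) T′ connected no-bypass

  module WithCentre (ctr : Centre (λ i → C u (w i)) (λ i → M u (w i))) where

    open Centre ctr
    open SpanningTree centre using (T′; T′-sym; spanning)

    C△ M△ : Fin 3 → Fin 3 → Bool
    C△ i j = others ∧ opposite centre i j
    M△ i j = not others ∧ opposite centre i j

    C′ M′ : V → V → Bool
    C′ = extend C C△
    M′ = extend M M△

    ∧-opposite-sym : ∀ b i j → b ∧ opposite centre i j ≡ b ∧ opposite centre j i
    ∧-opposite-sym b i j = cong (b ∧_) (opposite-sym centre i j)

    ∧-opposite⊆triangle : ∀ b i j → b ∧ opposite centre i j ≡ true → triangle i j ≡ true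
    ∧-opposite⊆triangle true  = opposite⊆triangle centre
    ∧-opposite⊆triangle false i j ()

    star∩∧-opposite : ∀ b i j → star centre i j ≡ true → b ∧ opposite centre i j ≡ false
    star∩∧-opposite b i j e = trans (cong (b ∧_) (star∩opposite centre i j e)) (Bool.∧-zeroʳ b)

    C△∩M△ : ∀ i j → C△ i j ≡ true → M△ i j ≡ false
    C△∩M△ i j e with others
    ... | true = refl

    cover′ : ∀ s t → inflateAdj G u w s t ≡ true → T′ s t ≡ true ⊎ (C′ s t ≡ true ⊎ M′ s t ≡ true)
    cover′ (inj₁ i) (inj₁ j) e with triangle⊆star∪opposite centre i j e | others
    ... | inj₁ in-star     | _     = inj₁ in-star
    ... | inj₂ in-opposite | true  = inj₂ (inj₁ in-opposite)
    ... | inj₂ in-opposite | false = inj₂ (inj₂ in-opposite)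
    cover′ (inj₁ i) (inj₂ y) e with w i ≟ old y
    ... | yes _ = cover u (w i) (w-adj i)
    cover′ (inj₂ x) (inj₁ j) e with w j ≟ old x
    ... | yes _ = cover u (w j) (w-adj j)
    cover′ (inj₂ x) (inj₂ y) e = cover (old x) (old y) e

    C′-new : ∀ i → Dec (i ≡ centre) → ZeroOrTwo (∑[ j < 3 ] ι (C△ i j) + ι (C u (w i)))
    C′-new i (yes refl) = inj₁ (cong₂ _+_ (∑-opposite-centre centre others) (cong ι centre∉C))
    C′-new i (no i≢c)   = subst ZeroOrTwo (sym (cong₂ _+_ (∑-opposite-other centre i others i≢c) (cong ι (other∈C i i≢c)))) (twice others)
      where
      twice : ∀ b → ZeroOrTwo (ι b + ι b)
      twice true  = inj₂ refl
      twice false = inj₁ refl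

    M′-new : ∀ i → Dec (i ≡ centre) → ∑[ j < 3 ] ι (M△ i j) + ι (M u (w i)) ≤ 1
    M′-new i (yes refl) = subst (_≤ 1) (sym (cong (_+ ι (M u (w centre))) (∑-opposite-centre centre (not others)))) (ι≤1 _)
    M′-new i (no i≢c)   = subst (_≤ 1) (sym (trans (cong₂ _+_ (∑-opposite-other centre i (not others) i≢c) (cong ι (other∉M i i≢c)))
                                              (+-identityʳ _)))
                                (ι≤1 _)

    C′-2reg : ∀ s → ZeroOrTwo (degV C′ s)
    C′-2reg (inj₁ i) = subst ZeroOrTwo (sym (deg-extend-new C C△ i)) (C′-new i (i ≟ centre))
    C′-2reg (inj₂ x) = subst ZeroOrTwo (sym (deg-extend-old C△ C-sym C⊆G x)) (C-2reg (old x))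

    M′-match : ∀ s → degV M′ s ≤ 1
    M′-match (inj₁ i) = subst (_≤ 1) (sym (deg-extend-new M M△ i)) (M′-new i (i ≟ centre))
    M′-match (inj₂ x) = subst (_≤ 1) (sym (deg-extend-old M△ M-sym M⊆G x)) (M-match (old x))

    decomposition : ThreeDecomposition (inflate G u w)
    decomposition = record
      { T = lift T′ ; C = lift C′ ; M = lift M′
      ; T-sym   = λ a b → T′-sym (splitAt 3 a) (splitAt 3 b)
      ; C-sym   = λ a b → extend-sym C-sym (∧-opposite-sym others) (splitAt 3 a) (splitAt 3 b)
      ; M-sym   = λ a b → extend-sym M-sym (∧-opposite-sym (not others)) (splitAt 3 a) (splitAt 3 b)
      ; T⊆G     = λ a b → extend⊆ T⊆G (star⊆triangle centre) (splitAt 3 a) (splitAt 3 b)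
      ; C⊆G     = λ a b → extend⊆ C⊆G (∧-opposite⊆triangle others) (splitAt 3 a) (splitAt 3 b)
      ; M⊆G     = λ a b → extend⊆ M⊆G (∧-opposite⊆triangle (not others)) (splitAt 3 a) (splitAt 3 b)
      ; cover   = λ a b → cover′ (splitAt 3 a) (splitAt 3 b)
      ; disjTC  = λ a b → extend-disjoint disjTC (star∩∧-opposite others) (splitAt 3 a) (splitAt 3 b)
      ; disjTM  = λ a b → extend-disjoint disjTM (star∩∧-opposite (not others)) (splitAt 3 a) (splitAt 3 b)
      ; disjCM  = λ a b → extend-disjoint disjCM C△∩M△ (splitAt 3 a) (splitAt 3 b)
      ; T-tree  = spanning
      ; C-2reg  = λ a → subst ZeroOrTwo (sym (deg-lift C′ a)) (C′-2reg (splitAt 3 a))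
      ; M-match = λ a → subst (_≤ 1) (sym (deg-lift M′ a)) (M′-match (splitAt 3 a))
      }

  decomposition : ThreeDecomposition (inflate G u w)
  decomposition = WithCentre.decomposition (choose-centre (λ i → C u (w i)) (λ i → M u (w i)) C-even M-small (λ i → disjCM u (w i)))
    where
    C-even : ZeroOrTwo (∑[ i < 3 ] ι (C u (w i)))
    C-even = subst ZeroOrTwo (deg≡∑-listed C u w w-inj (covers C⊆G)) (C-2reg u)
    M-small : ∑[ i < 3 ] ι (M u (w i)) ≤ 1
    M-small = subst (_≤ 1) (deg≡∑-listed M u w w-inj (covers M⊆G)) (M-match u)

lemma14 : ∀ {n} (G : Graph (suc n)) → IsSimple G → Cubic G →
          ThreeDecomposition G →
          (u : Fin (suc n)) (w : Fin 3 → Fin (suc n)) →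
          (∀ i j → w i ≡ w j → i ≡ j) → (∀ i → G u (w i) ≡ true) →
          ThreeDecomposition (inflate G u w)
lemma14 G G-simple cubic D u w w-inj w-adj =
  Inflation.decomposition G G-simple D u w (w-inj _ _) w-adj (covers-by-degree G u w (cubic u) (w-inj _ _) w-adj)
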